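{- Let $G$ be a simple graph with vertices $v_1,\dots,v_n$ and adjacency matrix $A\in\mathbb F_2^{n\times n}$, and suppose that either (a) every vertex of $G$ has even degree (zero allowed), and put $\bar N:=A^2+\mathbb I$; or (b) every vertex of $G$ has odd degree, and put $\bar N:=A^2$. Let $r$ be the rank of $\bar N$ over $\mathbb F_2$, let $w_1,\dots,w_{n-r}$ be a basis of $\ker\bar N$ and let $J\in\mathbb F_2^{(n-r)\times n}$ have rows $w_1^\top,\dots,w_{n-r}^\top$. Then in the Second Neighbors Lights Out game on $G$, an initial state $i$ can be transformed into a final state $f$ if and only if $Ji=Jf$.
   Context: Second Neighbors Lights Out game on $G$ (played only when all degrees are even/zero, or all degrees are odd): a state is $x\in\mathbb F_2^n$ ($x_j=1$ means the light at $v_j$ is on). Pressing the button at $v_i$ toggles the light at $v_i$ and the light at each vertex $v_k\neq v_i$ that is joined to $v_i$ by an odd number of paths of length $2$ (vertices joined to $v_i$ by an even number of such paths keep their status). All arithmetic is over $\mathbb F_2$. A state $i$ can be transformed into $f$ if some finite sequence of button presses turns $i$ into $f$. -}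

module Defs where

open import Data.Nat using (ℕ; _%_)
open import Data.Bool using (Bool; true; false; _xor_; _∧_; if_then_else_; not)
open import Data.Fin using (Fin; _≟_)
open import Data.List using (List; foldr; foldl; map; allFin)
open import Data.Nat.ListAction using (sum)
open import Data.Product using (∃; _×_)
open import Relation.Nullary using (does)
open import Relation.Binary.PropositionalEquality using (_≡_)

record SimpleGraph (n : ℕ) : Set where
  field
    adj   : Fin n → Fin n → Bool
    sym   : ∀ i j → adj i j ≡ adj j i
    loopless : ∀ i → adj i i ≡ false
open SimpleGraph public

-- States / vectors in F₂ⁿ, F₂ = Bool with xor as + and ∧ as ·.
State : ℕ → Set
State n = Fin n → Bool

⊕-sum : ∀ {n} → (Fin n → Bool) → Bool
⊕-sum {n} f = foldr _xor_ false (map f (allFin n))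

degree : ∀ {n} → SimpleGraph n → Fin n → ℕ
degree {n} G i = sum (map (λ j → if adj G i j then 1 else 0) (allFin n))

paths2 : ∀ {n} → SimpleGraph n → Fin n → Fin n → ℕ
paths2 {n} G i k = sum (map (λ j → if adj G i j ∧ adj G j k then 1 else 0) (allFin n))

data DegParity : Set where
  allEven allOdd : DegParity

parityBit : DegParity → ℕ
parityBit allEven = 0
parityBit allOdd  = 1

AllDegrees : ∀ {n} → SimpleGraph n → DegParity → Set
AllDegrees G p = ∀ i → degree G i % 2 ≡ parityBit p

toggles : ∀ {n} → SimpleGraph n → Fin n → Fin n → Bool
toggles G i k = if does (i ≟ k) then true else (if paths2 G i k % 2 ≡ᵇ 1 then true else false)
  where
  open import Data.Nat using (_≡ᵇ_)

press : ∀ {n} → SimpleGraph n → Fin n → State n → State n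
press G i x k = x k xor toggles G i k

pressAll : ∀ {n} → SimpleGraph n → List (Fin n) → State n → State n
pressAll G ps x = foldl (λ s i → press G i s) x ps

Transformable : ∀ {n} → SimpleGraph n → State n → State n → Set
Transformable G x y = ∃ λ ps → ∀ k → pressAll G ps x k ≡ y k

Matrix : ℕ → ℕ → Set
Matrix m n = Fin m → Fin n → Bool

identity : ∀ {n} → Matrix n n
identity i j = does (i ≟ j)

_⊕ᴹ_ : ∀ {m n} → Matrix m n → Matrix m n → Matrix m n
(M ⊕ᴹ N) i j = M i j xor N i j

_·ᴹ_ : ∀ {m n p} → Matrix m n → Matrix n p → Matrix m p
(M ·ᴹ N) i k = ⊕-sum (λ j → M i j ∧ N j k)

_·ᵛ_ : ∀ {m n} → Matrix m n → State n → State m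
(M ·ᵛ x) i = ⊕-sum (λ j → M i j ∧ x j)

adjMatrix : ∀ {n} → SimpleGraph n → Matrix n n
adjMatrix G = adj G

Nbar : ∀ {n} → SimpleGraph n → DegParity → Matrix n n
Nbar G allEven = (adjMatrix G ·ᴹ adjMatrix G) ⊕ᴹ identity
Nbar G allOdd  = adjMatrix G ·ᴹ adjMatrix G

InKernel : ∀ {m n} → Matrix m n → State n → Set
InKernel M v = ∀ i → (M ·ᵛ v) i ≡ false

lincomb : ∀ {m n} → (Fin m → Bool) → (Fin m → State n) → State n
lincomb c w k = ⊕-sum (λ l → c l ∧ w l k)

IsKernelBasis : ∀ {m n} → Matrix m n → ∀ {d} → (Fin d → State n) → Set
IsKernelBasis M w =
  (∀ l → InKernel M (w l))
  × (∀ c → (∀ k → lincomb c w k ≡ false) → ∀ l → c l ≡ false)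
  × (∀ v → InKernel M v → ∃ λ c → ∀ k → lincomb c w k ≡ v k)

rowsMatrix : ∀ {d n} → (Fin d → State n) → Matrix d n
rowsMatrix w = w

module Submission where

-- Let T be the toggle matrix of the game (row j = the lights
-- toggled by button j).  A sequence of presses adds a sum of rows of T to
-- the state over F₂, so i can be turned into f iff i + f is in the row
-- space of T.
-- Theorem: rows of J lie in ker N̄, giving invariance of Jx.  Conversely if
-- Ji = Jf, i + f is orthogonal to the spanning family w, hence to ker N̄,
-- which rules out a Farkas separator; so i + f is in the row space of T.

open import Defs hiding (sym)
open import Data.Nat using (ℕ; zero; suc; _%_; _≡ᵇ_)
open import Data.Fin using (Fin; zero; suc; _≟_)
open import Data.Fin.Properties using (any?)
open import Data.Bool using (Bool; true; false; _xor_; _∧_; if_then_else_; not)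
open import Data.Bool.Properties as Bool
  using ( xor-assoc; xor-comm; xor-identityʳ; xor-same; ∧-idem; ∧-assoc; ∧-zeroʳ
        ; ∧-distribˡ-xor; ∧-distribʳ-xor; ∧-comm; ¬-not; xor-∧-commutativeRing )
open import Data.List using (List; []; _∷_; foldr; map; allFin; tabulate; filterᵇ)
open import Data.List.Properties using (map-tabulate; map-cong)
open import Data.Nat.ListAction using () renaming (sum to sumℕ)
open import Data.Vec.Functional using () renaming (_∷_ to _∷ᵛ_)
open import Data.Product using (_×_; _,_; ∃)
open import Data.Sum using (_⊎_; inj₁; inj₂)
open import Function using (_∘_; id)
open import Function.Bundles using (_⇔_; mk⇔)
open import Relation.Nullary using (yes; no; contradiction)
open import Relation.Binary.PropositionalEquality
open import Algebra.Bundles using (CommutativeRing)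
open CommutativeRing xor-∧-commutativeRing using (semiring)
open import Algebra.Properties.Semiring.Sum semiring
  using (sum; sum-syntax; sum-cong-≗; sum-replicate-zero; ∑-distrib-+; ∑-comm
        ; *-distribˡ-sum; *-distribʳ-sum)

⊕-sum≡∑ : ∀ {n} (f : Fin n → Bool) → ⊕-sum f ≡ sum f
⊕-sum≡∑ {n} f = trans (cong (foldr _xor_ false) (map-tabulate id f)) (foldr-tabulate f)
  where
  foldr-tabulate : ∀ {m} (g : Fin m → Bool) → foldr _xor_ false (tabulate g) ≡ sum g
  foldr-tabulate {zero}  g = refl
  foldr-tabulate {suc m} g = cong (g zero xor_) (foldr-tabulate (g ∘ suc))

infixl 6 _⊕_
infix  7 _∙_

_⊕_ : ∀ {n} → State n → State n → State n
(x ⊕ y) k = x k xor y k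

_∙_ : ∀ {n} → State n → State n → Bool
_∙_ {n} x y = ∑[ k < n ] (x k ∧ y k)

·ᵛ-row : ∀ {m n} (M : Matrix m n) (x : State n) j → (M ·ᵛ x) j ≡ M j ∙ x
·ᵛ-row M x j = ⊕-sum≡∑ (λ k → M j k ∧ x k)

∙-comm : ∀ {n} (x y : State n) → x ∙ y ≡ y ∙ x
∙-comm x y = sum-cong-≗ (λ k → ∧-comm (x k) (y k))

∙-distribˡ-⊕ : ∀ {n} (x y z : State n) → x ∙ (y ⊕ z) ≡ x ∙ y xor x ∙ z
∙-distribˡ-⊕ x y z =
  trans (sum-cong-≗ (λ k → ∧-distribˡ-xor (x k) (y k) (z k)))
        (∑-distrib-+ (λ k → x k ∧ y k) (λ k → x k ∧ z k))

∙-distribʳ-⊕ : ∀ {n} (x y z : State n) → (x ⊕ y) ∙ z ≡ x ∙ z xor y ∙ z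
∙-distribʳ-⊕ x y z =
  trans (sum-cong-≗ (λ k → ∧-distribʳ-xor (z k) (x k) (y k)))
        (∑-distrib-+ (λ k → x k ∧ z k) (λ k → y k ∧ z k))

combo : ∀ {m n} → (Fin m → Bool) → Matrix m n → State n
combo {m} c R k = ∑[ j < m ] (c j ∧ R j k)

combo-∙ : ∀ {m n} (c : Fin m → Bool) (R : Matrix m n) (v : State n) →
  combo c R ∙ v ≡ ∑[ j < m ] (c j ∧ R j ∙ v)
combo-∙ {m} {n} c R v = begin
  ∑[ k < n ] (∑[ j < m ] (c j ∧ R j k) ∧ v k)
    ≡⟨ sum-cong-≗ (λ k → *-distribʳ-sum (v k) (λ j → c j ∧ R j k)) ⟩
  ∑[ k < n ] ∑[ j < m ] ((c j ∧ R j k) ∧ v k)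
    ≡⟨ ∑-comm (λ k j → (c j ∧ R j k) ∧ v k) ⟩
  ∑[ j < m ] ∑[ k < n ] ((c j ∧ R j k) ∧ v k)
    ≡⟨ sum-cong-≗ (λ j → trans (sum-cong-≗ (λ k → ∧-assoc (c j) (R j k) (v k)))
                               (sym (*-distribˡ-sum (c j) (λ k → R j k ∧ v k)))) ⟩
  ∑[ j < m ] (c j ∧ R j ∙ v) ∎
  where open ≡-Reasoning

xor-cancelʳ : ∀ x y → (x xor y) xor y ≡ x
xor-cancelʳ x y = trans (xor-assoc x y y) (trans (cong (x xor_) (xor-same y)) (xor-identityʳ x))

unit : ∀ {n} → Fin n → State n
unit zero    zero    = true
unit zero    (suc _) = false
unit (suc _) zero    = false
unit (suc k) (suc j) = unit k j

unit-∙ : ∀ {n} (k : Fin n) (v : State n) → unit k ∙ v ≡ v k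
unit-∙ {suc n} zero    v = trans (cong (v zero xor_) (sum-replicate-zero n)) (xor-identityʳ (v zero))
unit-∙ {suc n} (suc k) v = unit-∙ k (v ∘ suc)

-- The Farkas alternative over F₂.

InRowSpace : ∀ {m n} → Matrix m n → State n → Set
InRowSpace R v = ∃ λ c → ∀ k → combo c R k ≡ v k

Orthogonal : ∀ {m n} → Matrix m n → State n → Set
Orthogonal R μ = ∀ j → R j ∙ μ ≡ false

-- μ certifies that v is outside the row space of R.
Separates : ∀ {m n} → Matrix m n → State n → State n → Set
Separates R v μ = Orthogonal R μ × μ ∙ v ≡ true

orthogonal-∷ : ∀ {m n} {R : Matrix (suc m) n} {μ : State n} →
  R zero ∙ μ ≡ false → Orthogonal (R ∘ suc) μ → Orthogonal R μ
orthogonal-∷ r₀μ μ⊥ zero    = r₀μ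
orthogonal-∷ r₀μ μ⊥ (suc j) = μ⊥ j

∙-shift : ∀ {n} (μ v r : State n) → μ ∙ v ≡ μ ∙ (v ⊕ r) xor r ∙ μ
∙-shift μ v r = sym (begin
  μ ∙ (v ⊕ r) xor r ∙ μ          ≡⟨ cong (_xor r ∙ μ) (∙-distribˡ-⊕ μ v r) ⟩
  (μ ∙ v xor μ ∙ r) xor r ∙ μ    ≡⟨ cong (λ b → (μ ∙ v xor b) xor r ∙ μ) (∙-comm μ r) ⟩
  (μ ∙ v xor r ∙ μ) xor r ∙ μ    ≡⟨ xor-cancelʳ (μ ∙ v) (r ∙ μ) ⟩
  μ ∙ v                          ∎)
  where open ≡-Reasoning

-- Separators of v and of v + R₀ from the lower rows yield a separator of v
-- from all rows: one of μ, ν, μ + ν is also orthogonal to R₀.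
separator-step : ∀ {m n} (R : Matrix (suc m) n) (v : State n) →
  ∃ (Separates (R ∘ suc) v) → ∃ (Separates (R ∘ suc) (v ⊕ R zero)) → ∃ (Separates R v)
separator-step R v (μ , μ⊥ , μv) (ν , ν⊥ , νv′) with R zero ∙ μ in r₀μ | R zero ∙ ν in r₀ν
... | false | _     = μ , orthogonal-∷ {R = R} r₀μ μ⊥ , μv
... | true  | false = ν , orthogonal-∷ {R = R} r₀ν ν⊥ , νv
  where
  νv : ν ∙ v ≡ true
  νv = trans (∙-shift ν v (R zero)) (cong₂ _xor_ νv′ r₀ν)
... | true  | true  = μ ⊕ ν , μν⊥ , trans (∙-distribʳ-⊕ μ ν v) (cong₂ _xor_ μv νv)
  where
  νv : ν ∙ v ≡ false
  νv = trans (∙-shift ν v (R zero)) (cong₂ _xor_ νv′ r₀ν)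

  μν⊥ : Orthogonal R (μ ⊕ ν)
  μν⊥ j = trans (∙-distribˡ-⊕ (R j) μ ν) (orthogonal-both j)
    where
    orthogonal-both : ∀ j → R j ∙ μ xor R j ∙ ν ≡ false
    orthogonal-both zero    = cong₂ _xor_ r₀μ r₀ν
    orthogonal-both (suc j) = cong₂ _xor_ (μ⊥ j) (ν⊥ j)

row-space-alternative : ∀ {m n} (R : Matrix m n) (v : State n) →
  InRowSpace R v ⊎ ∃ (Separates R v)
row-space-alternative {zero} R v with any? (λ k → v k Bool.≟ true)
... | yes (k , vk) = inj₂ (unit k , (λ ()) , trans (unit-∙ k v) vk)
... | no none      = inj₁ ((λ ()) , λ k → sym (¬-not (λ vk → none (k , vk))))
row-space-alternative {suc m} R v
  with row-space-alternative (R ∘ suc) v | row-space-alternative (R ∘ suc) (v ⊕ R zero)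
... | inj₁ (c , hc) | _             = inj₁ (false ∷ᵛ c , hc)
... | inj₂ _        | inj₁ (c , hc) =
  inj₁ (true ∷ᵛ c , λ k → trans (cong (R zero k xor_) (hc k))
                               (trans (xor-comm (R zero k) _) (xor-cancelʳ (v k) (R zero k))))
... | inj₂ sμ       | inj₂ sν       = inj₂ (separator-step R v sμ sν)

isOdd : ℕ → Bool
isOdd s = s % 2 ≡ᵇ 1

isOdd-suc : ∀ s → isOdd (suc s) ≡ not (isOdd s)
isOdd-suc zero    = refl
isOdd-suc (suc s) = sym (trans (cong not (isOdd-suc s)) (Bool.not-involutive (isOdd s)))

count : ∀ {A : Set} → (A → Bool) → List A → ℕ
count f xs = sumℕ (map (λ x → if f x then 1 else 0) xs)

xor-parity : ∀ {A : Set} (f : A → Bool) (xs : List A) →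
  foldr _xor_ false (map f xs) ≡ isOdd (count f xs)
xor-parity f []       = refl
xor-parity f (x ∷ xs) with f x
... | true  = trans (cong not (xor-parity f xs)) (sym (isOdd-suc (count f xs)))
... | false = xor-parity f xs

xor-filter : ∀ {A : Set} (c g : A → Bool) (xs : List A) →
  foldr _xor_ false (map g (filterᵇ c xs)) ≡ foldr _xor_ false (map (λ x → c x ∧ g x) xs)
xor-filter c g []       = refl
xor-filter c g (x ∷ xs) with c x
... | true  = cong (g x xor_) (xor-filter c g xs)
... | false = xor-filter c g xs

if-bool : ∀ b → (if b then true else false) ≡ b
if-bool true  = refl
if-bool false = refl

module _ {n : ℕ} (G : SimpleGraph n) where

  A²-entry : ∀ i k → (adj G ·ᴹ adj G) i k ≡ isOdd (paths2 G i k)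
  A²-entry i k = xor-parity (λ j → adj G i j ∧ adj G j k) (allFin n)

  paths2-diag : ∀ i → paths2 G i i ≡ degree G i
  paths2-diag i = cong sumℕ (map-cong (λ j → cong (λ b → if b then 1 else 0) (adj-twice j)) (allFin n))
    where
    adj-twice : ∀ j → adj G i j ∧ adj G j i ≡ adj G i j
    adj-twice j = trans (cong (adj G i j ∧_) (SimpleGraph.sym G j i)) (∧-idem (adj G i j))

  A²-diag : ∀ {p} → AllDegrees G p → ∀ i → (adj G ·ᴹ adj G) i i ≡ (parityBit p ≡ᵇ 1)
  A²-diag h i =
    trans (A²-entry i i) (trans (cong isOdd (paths2-diag i)) (cong (_≡ᵇ 1) (h i)))

  toggles≡Nbar : ∀ {p} → AllDegrees G p → ∀ i k → toggles G i k ≡ Nbar G p i k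
  toggles≡Nbar {allEven} h i k with i ≟ k
  ... | yes refl = sym (cong (_xor true) (A²-diag h i))
  ... | no _     = trans (if-bool _) (sym (trans (xor-identityʳ _) (A²-entry i k)))
  toggles≡Nbar {allOdd}  h i k with i ≟ k
  ... | yes refl = sym (A²-diag h i)
  ... | no _     = trans (if-bool _) (sym (A²-entry i k))

  kernel⇒orthogonal : ∀ {p} → AllDegrees G p → ∀ {μ} → InKernel (Nbar G p) μ → Orthogonal (toggles G) μ
  kernel⇒orthogonal {p} h {μ} μ∈ker j =
    trans (sum-cong-≗ (λ k → cong (_∧ μ k) (toggles≡Nbar h j k)))
          (trans (sym (·ᵛ-row (Nbar G p) μ j)) (μ∈ker j))

  orthogonal⇒kernel : ∀ {p} → AllDegrees G p → ∀ {μ} → Orthogonal (toggles G) μ → InKernel (Nbar G p) μ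
  orthogonal⇒kernel {p} h {μ} μ⊥ j =
    trans (·ᵛ-row (Nbar G p) μ j)
          (trans (sum-cong-≗ (λ k → cong (_∧ μ k) (sym (toggles≡Nbar h j k)))) (μ⊥ j))

  effect : List (Fin n) → State n
  effect ps k = foldr _xor_ false (map (λ j → toggles G j k) ps)

  pressAll-effect : ∀ ps x k → pressAll G ps x k ≡ x k xor effect ps k
  pressAll-effect []       x k = sym (xor-identityʳ (x k))
  pressAll-effect (j ∷ ps) x k =
    trans (pressAll-effect ps (press G j x) k) (xor-assoc (x k) (toggles G j k) (effect ps k))

  effect-select : ∀ c k → effect (filterᵇ c (allFin n)) k ≡ combo c (toggles G) k
  effect-select c k =
    trans (xor-filter c (λ j → toggles G j k) (allFin n)) (⊕-sum≡∑ (λ j → c j ∧ toggles G j k))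

  row-space⇒transformable : ∀ {x y} → InRowSpace (toggles G) (x ⊕ y) → Transformable G x y
  row-space⇒transformable {x} {y} (c , hc) = presses , λ k → begin
    pressAll G presses x k    ≡⟨ pressAll-effect presses x k ⟩
    x k xor effect presses k  ≡⟨ cong (x k xor_) (trans (effect-select c k) (hc k)) ⟩
    x k xor (x k xor y k)     ≡⟨ sym (xor-assoc (x k) (x k) (y k)) ⟩
    (x k xor x k) xor y k     ≡⟨ cong (_xor y k) (xor-same (x k)) ⟩
    y k                       ∎
    where
    open ≡-Reasoning
    presses : List (Fin n)
    presses = filterᵇ c (allFin n)

  press-invariant : ∀ {w} → Orthogonal (toggles G) w → ∀ ps x → w ∙ pressAll G ps x ≡ w ∙ x
  press-invariant         w⊥ []       x = refl
  press-invariant {w = w} w⊥ (j ∷ ps) x = begin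
    w ∙ pressAll G ps (press G j x)  ≡⟨ press-invariant w⊥ ps (press G j x) ⟩
    w ∙ (x ⊕ toggles G j)            ≡⟨ ∙-distribˡ-⊕ w x (toggles G j) ⟩
    w ∙ x xor w ∙ toggles G j        ≡⟨ cong (w ∙ x xor_) (trans (∙-comm w (toggles G j)) (w⊥ j)) ⟩
    w ∙ x xor false                  ≡⟨ xor-identityʳ (w ∙ x) ⟩
    w ∙ x                            ∎
    where open ≡-Reasoning

orthogonal-to-kernel : ∀ {m n d} {M : Matrix m n} {w : Fin d → State n} →
  (∀ u → InKernel M u → ∃ λ c → ∀ k → lincomb c w k ≡ u k) →
  ∀ {v} → (∀ l → w l ∙ v ≡ false) → ∀ {μ} → InKernel M μ → μ ∙ v ≡ false
orthogonal-to-kernel {d = d} {w = w} w-spans {v} w⊥v {μ} μ∈ker with w-spans μ μ∈ker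
... | c , μ≡cw = begin
  μ ∙ v                          ≡⟨ sum-cong-≗ (λ k → cong (_∧ v k) (trans (sym (μ≡cw k)) (⊕-sum≡∑ (λ l → c l ∧ w l k)))) ⟩
  combo c w ∙ v                  ≡⟨ combo-∙ c w v ⟩
  ∑[ l < d ] (c l ∧ w l ∙ v)     ≡⟨ sum-cong-≗ (λ l → trans (cong (c l ∧_) (w⊥v l)) (∧-zeroʳ (c l))) ⟩
  ∑[ l < d ] false               ≡⟨ sum-replicate-zero d ⟩
  false                          ∎
  where open ≡-Reasoning

theorem3 : (n : ℕ) (G : SimpleGraph n) (p : DegParity) → AllDegrees G p →
    (d : ℕ) (w : Fin d → State n) → IsKernelBasis (Nbar G p) w →
    (i f : State n) →
    Transformable G i f ⇔ (∀ l → (rowsMatrix w ·ᵛ i) l ≡ (rowsMatrix w ·ᵛ f) l)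
theorem3 n G p degrees d w (w∈ker , _ , w-spans) i f = mk⇔ invariant reachable
  where
  open ≡-Reasoning

  -- Each row of J is in ker N̄, so Jx is unchanged by presses.
  invariant : Transformable G i f → ∀ l → (rowsMatrix w ·ᵛ i) l ≡ (rowsMatrix w ·ᵛ f) l
  invariant (ps , ps-ok) l = begin
    (rowsMatrix w ·ᵛ i) l   ≡⟨ ·ᵛ-row w i l ⟩
    w l ∙ i                 ≡⟨ sym (press-invariant G (kernel⇒orthogonal G degrees (w∈ker l)) ps i) ⟩
    w l ∙ pressAll G ps i   ≡⟨ sum-cong-≗ (λ k → cong (w l k ∧_) (ps-ok k)) ⟩
    w l ∙ f                 ≡⟨ sym (·ᵛ-row w f l) ⟩
    (rowsMatrix w ·ᵛ f) l   ∎

  -- If Ji = Jf, a Farkas separator of i + f would lie in ker N̄ yet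
  -- not be orthogonal to i + f; so i + f is in the row space.
  reachable : (∀ l → (rowsMatrix w ·ᵛ i) l ≡ (rowsMatrix w ·ᵛ f) l) → Transformable G i f
  reachable Ji≡Jf with row-space-alternative (toggles G) (i ⊕ f)
  ... | inj₁ in-rows         = row-space⇒transformable G in-rows
  ... | inj₂ (μ , μ⊥ , μ∙v) =
    contradiction (trans (sym μ∙v) (orthogonal-to-kernel w-spans w⊥v (orthogonal⇒kernel G degrees μ⊥))) λ ()
    where
    w⊥v : ∀ l → w l ∙ (i ⊕ f) ≡ false
    w⊥v l = begin
      w l ∙ (i ⊕ f)        ≡⟨ ∙-distribˡ-⊕ (w l) i f ⟩
      w l ∙ i xor w l ∙ f  ≡⟨ cong (_xor w l ∙ f) (trans (sym (·ᵛ-row w i l)) (trans (Ji≡Jf l) (·ᵛ-row w f l))) ⟩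
      w l ∙ f xor w l ∙ f  ≡⟨ xor-same (w l ∙ f) ⟩
      false                ∎
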